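{- Let $i,j$ be positive integers and $l\geq 2$ an integer. If there exists an $(i,j)$ phylogeny graph containing an induced subgraph isomorphic to $K_l$, then for every positive integer $m$ there exists an $(i+m,j)$ phylogeny graph containing an induced subgraph isomorphic to $K_{l+m}$.
   Context: An $(i,j)$ digraph is an acyclic digraph in which every vertex has indegree at most $i$ and outdegree at most $j$. The phylogeny graph $P(D)$ has vertex set $V(D)$ and an edge between distinct $u,v$ iff $(u,v)\in A(D)$ or $(v,u)\in A(D)$ or $u,v$ have a common out-neighbor in $D$. A graph is an $(i,j)$ phylogeny graph if it is isomorphic to $P(D)$ for some $(i,j)$ digraph $D$. -}

module Defs where

open import Data.Nat using (ℕ; zero; suc; _+_; _≤_)
open import Data.Fin using (Fin)
open import Data.Bool using (Bool; true; false; T)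
open import Data.List using (List; length; filter)
open import Data.List using () renaming (map to lmap)
open import Data.Fin using () renaming (toℕ to toℕ)
open import Data.Product using (Σ; _×_; ∃; ∃-syntax; _,_)
open import Data.Sum using (_⊎_)
open import Data.Fin.Base using ()
open import Data.List.Base using ()
open import Relation.Nullary using (¬_)
open import Relation.Binary.PropositionalEquality using (_≡_)
open import Function.Bundles using (_↔_; Inverse)
open import Function.Definitions using (Injective)
open import Data.Vec.Functional using ()
open import Data.List using ()
open import Data.Fin using (_≟_)
import Data.List.Base as L
open import Data.Fin.Base using ()

allFin : (n : ℕ) → List (Fin n)
allFin n = L.allFin n

record Digraph (n : ℕ) : Set where
  field
    arc : Fin n → Fin n → Bool
open Digraph public

Arc : ∀ {n} → Digraph n → Fin n → Fin n → Set
Arc D u v = T (arc D u v)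

data Reach {n} (D : Digraph n) : Fin n → Fin n → Set where
  step : ∀ {u v} → Arc D u v → Reach D u v
  _then_ : ∀ {u v w} → Arc D u v → Reach D v w → Reach D u w

Acyclic : ∀ {n} → Digraph n → Set
Acyclic {n} D = (v : Fin n) → ¬ Reach D v v

outdeg : ∀ {n} → Digraph n → Fin n → ℕ
outdeg {n} D u = length (L.filter (λ v → Data.Bool._≟_ (arc D u v) true) (allFin n))

indeg : ∀ {n} → Digraph n → Fin n → ℕ
indeg {n} D v = length (L.filter (λ u → Data.Bool._≟_ (arc D u v) true) (allFin n))

IJDigraph : ℕ → ℕ → ∀ {n} → Digraph n → Set
IJDigraph i j {n} D = Acyclic D × ((v : Fin n) → indeg D v ≤ i × outdeg D v ≤ j)

record Graph (n : ℕ) : Set₁ where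
  field
    Adj : Fin n → Fin n → Set
    irrefl : ∀ u → ¬ Adj u u
    sym : ∀ {u v} → Adj u v → Adj v u
open Graph public

PhyAdj : ∀ {n} → Digraph n → Fin n → Fin n → Set
PhyAdj {n} D u v =
  ¬ (u ≡ v) × (Arc D u v ⊎ Arc D v u ⊎ ∃[ w ] (Arc D u w × Arc D v w))

P : ∀ {n} → Digraph n → Graph n
P D = record
  { Adj = PhyAdj D
  ; irrefl = λ u h → let (ne , _) = h in ne Relation.Binary.PropositionalEquality.refl
  ; sym = λ { (ne , Data.Sum.inj₁ a) → (λ e → ne (Relation.Binary.PropositionalEquality.sym e)) , Data.Sum.inj₂ (Data.Sum.inj₁ a)
            ; (ne , Data.Sum.inj₂ (Data.Sum.inj₁ a)) → (λ e → ne (Relation.Binary.PropositionalEquality.sym e)) , Data.Sum.inj₁ a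
            ; (ne , Data.Sum.inj₂ (Data.Sum.inj₂ (w , a , b))) → (λ e → ne (Relation.Binary.PropositionalEquality.sym e)) , Data.Sum.inj₂ (Data.Sum.inj₂ (w , b , a)) }
  }

record _≅_ {n m : ℕ} (G : Graph n) (H : Graph m) : Set where
  field
    bij : Fin n ↔ Fin m
    preserves : ∀ u v → Adj G u v → Adj H (Inverse.to bij u) (Inverse.to bij v)
    reflects : ∀ u v → Adj H (Inverse.to bij u) (Inverse.to bij v) → Adj G u v

IsPhylogenyGraph : ℕ → ℕ → ∀ {n} → Graph n → Set
IsPhylogenyGraph i j {n} G = Σ (Digraph n) λ D → IJDigraph i j D × (G ≅ P D)

ContainsInducedClique : ∀ {n} → Graph n → ℕ → Set
ContainsInducedClique {n} G l =
  Σ (Fin l → Fin n) λ f → Injective _≡_ _≡_ f × (∀ a b → ¬ (a ≡ b) → Adj G (f a) (f b))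

{-# OPTIONS --safe #-}
-- Let K be an l-clique (l ≥ 2) in the phylogeny graph of an acyclic digraph D, and let y ∈ K
-- be a vertex with no in-neighbour in K (it exists by acyclicity).  Add to D a new vertex x
-- with the same out-neighbours as y and no in-neighbours.  This keeps D acyclic, raises each
-- in-degree by at most one and gives x the out-degree of y, while x becomes
-- adjacent to all of K: a vertex of K either is an out-neighbour of y or shares one with y,
-- and y itself has an out-neighbour since it is adjacent to another vertex of K.  Repeat m times.
module Submission where

open import Defs
open import Data.Nat using (ℕ; _+_; _≤_)
open import Data.Product using (Σ; _×_)

open import Data.Bool using (Bool; true; false) renaming (_≟_ to _≟ᵇ_)
open import Data.Bool.Properties using (T?)
open import Data.Empty using (⊥; ⊥-elim)
open import Data.Fin using (Fin; zero; suc; toℕ; punchIn) renaming (_≟_ to _≟ᶠ_; _<_ to _<ᶠ_)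
open import Data.Fin.Properties using (any?; pigeonhole; suc-injective; punchInᵢ≢i)
open import Data.List using (List; []; _∷_; length; map; filter; tabulate)
open import Data.List.Properties using (length-filter; filter-none; map-tabulate)
open import Data.List.Relation.Unary.All using (universal)
open import Data.Nat using (suc; _<_; s≤s; z≤n)
open import Data.Nat.GeneralisedArithmetic using (fold)
open import Data.Nat.Properties using (≤-trans; +-comm; +-monoˡ-≤; m≤n⇒m<n∨m≡n; m≤n+m; n<1+n)
open import Data.Product using (_,_; proj₁; proj₂; ∃₂; ∃-syntax)
open import Data.Sum using (_⊎_; inj₁; inj₂)
open import Function using (_∘_; Injective)
open import Function.Bundles using (Inverse)
open import Function.Construct.Identity using (↔-id)
open import Relation.Binary.PropositionalEquality using (_≡_; _≢_; refl; trans; cong; subst; subst₂)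
import Relation.Binary.PropositionalEquality as ≡
open import Relation.Nullary using (¬_; Dec; yes; no; ¬?; does)
open import Relation.Nullary.Decidable using (decidable-stable)
open import Relation.Unary using (Pred; Decidable)

length-filter-map : ∀ {a b p} {A : Set a} {B : Set b} {P : Pred B p} (P? : Decidable P)
  (f : A → B) (xs : List A) →
  length (filter P? (map f xs)) ≡ length (filter (P? ∘ f) xs)
length-filter-map P? f [] = refl
length-filter-map P? f (x ∷ xs) with does (P? (f x))
... | true = cong suc (length-filter-map P? f xs)
... | false = length-filter-map P? f xs

length-filter-tabulate : ∀ {n a p} {A : Set a} {P : Pred A p} (P? : Decidable P) (f : Fin n → A) →
  length (filter P? (tabulate f)) ≡ length (filter (P? ∘ f) (allFin n))
length-filter-tabulate {n} P? f =
  trans (cong (length ∘ filter P?) (≡.sym (map-tabulate (λ x → x) f)))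
        (length-filter-map P? f (allFin n))

length-filter-allFin-suc : ∀ {n p} {P : Pred (Fin (suc n)) p} (P? : Decidable P) →
  length (filter P? (allFin (suc n))) ≡
  length (filter P? (zero ∷ [])) + length (filter (P? ∘ suc) (allFin n))
length-filter-allFin-suc P? with does (P? zero)
... | true = cong suc (length-filter-tabulate P? suc)
... | false = length-filter-tabulate P? suc

Clique : ∀ {n} → Graph n → ℕ → Set
Clique {n} G l = Σ (Fin l → Fin n) λ f → ∀ a b → a ≢ b → Adj G (f a) (f b)

Clique⇒ContainsInducedClique : ∀ {n l} {G : Graph n} → Clique G l → ContainsInducedClique G l
Clique⇒ContainsInducedClique {G = G} (f , adj) = f , injective , adj
  where
  injective : Injective _≡_ _≡_ f
  injective {a} {b} fa≡fb with a ≟ᶠ b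
  ... | yes a≡b = a≡b
  ... | no a≢b = ⊥-elim (irrefl G (f b) (subst (λ v → Adj G v (f b)) fa≡fb (adj a b a≢b)))

Clique-≅ : ∀ {n m l} {G : Graph n} {H : Graph m} → G ≅ H → Clique G l → Clique H l
Clique-≅ G≅H (f , adj) = to ∘ f , λ a b a≢b → preserves (f a) (f b) (adj a b a≢b)
  where
  open _≅_ G≅H
  open Inverse bij using (to)

P-isPhylogenyGraph : ∀ {i j n} {D : Digraph n} → IJDigraph i j D → IsPhylogenyGraph i j (P D)
P-isPhylogenyGraph {D = D} ij =
  D , ij , record { bij = ↔-id _ ; preserves = λ _ _ adj → adj ; reflects = λ _ _ adj → adj }

module _ {n} (D : Digraph n) where

  reach-fold : ∀ {l} (f : Fin l → Fin n) (pred : Fin l → Fin l) →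
    (∀ a → Arc D (f (pred a)) (f a)) →
    ∀ a {s t} → s < t → Reach D (f (fold a pred t)) (f (fold a pred s))
  reach-fold f pred arc-pred a {t = suc t} (s≤s s≤t) with m≤n⇒m<n∨m≡n s≤t
  ... | inj₁ s<t = arc-pred (fold a pred t) then reach-fold f pred arc-pred a s<t
  ... | inj₂ refl = step (arc-pred (fold a pred t))

  acyclic⇒no-predecessor-map : Acyclic D → ∀ {l} (f : Fin (suc l) → Fin n)
    (pred : Fin (suc l) → Fin (suc l)) → ¬ (∀ a → Arc D (f (pred a)) (f a))
  acyclic⇒no-predecessor-map acyclic {l} f pred arc-pred = cycle (pigeonhole (n<1+n (suc l)) walk)
    where
    walk : Fin (suc (suc l)) → Fin (suc l)
    walk t = fold zero pred (toℕ t)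

    cycle : ∃₂ (λ s t → s <ᶠ t × walk s ≡ walk t) → ⊥
    cycle (s , t , s<t , walk-s≡walk-t) = acyclic (f (walk t))
      (subst (λ v → Reach D (f (walk t)) (f v)) walk-s≡walk-t (reach-fold f pred arc-pred zero s<t))

  has-in-neighbour? : ∀ {l} (f : Fin l → Fin n) a → Dec (∃[ b ] Arc D (f b) (f a))
  has-in-neighbour? f a = any? (λ b → T? (arc D (f b) (f a)))

  acyclic⇒source : Acyclic D → ∀ {l} (f : Fin (suc l) → Fin n) →
    ∃[ a ] (∀ b → ¬ Arc D (f b) (f a))
  acyclic⇒source acyclic f with any? (¬? ∘ has-in-neighbour? f)
  ... | yes (a , none) = a , λ b arc → none (b , arc)
  ... | no no-source =
    ⊥-elim (acyclic⇒no-predecessor-map acyclic f (proj₁ ∘ in-neighbour) (proj₂ ∘ in-neighbour))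
    where
    in-neighbour : ∀ a → ∃[ b ] Arc D (f b) (f a)
    in-neighbour a = decidable-stable (has-in-neighbour? f a) (λ none → no-source (a , none))

twinArc : ∀ {n} → Digraph n → Fin n → Fin (suc n) → Fin (suc n) → Bool
twinArc D y _ zero = false
twinArc D y zero (suc v) = arc D y v
twinArc D y (suc u) (suc v) = arc D u v

-- The new vertex is zero; the vertices of D are shifted by suc.
addOutTwin : ∀ {n} → Digraph n → Fin n → Digraph (suc n)
addOutTwin D y = record { arc = twinArc D y }

ForwardAdj : ∀ {n} → Digraph n → Fin n → Fin n → Set
ForwardAdj D y u = Arc D y u ⊎ ∃[ w ] (Arc D y w × Arc D u w)

PhyAdj⇒ForwardAdj : ∀ {n} {D : Digraph n} {y u} → ¬ Arc D u y → PhyAdj D y u → ForwardAdj D y u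
PhyAdj⇒ForwardAdj _ (_ , inj₁ y→u) = inj₁ y→u
PhyAdj⇒ForwardAdj ¬u→y (_ , inj₂ (inj₁ u→y)) = ⊥-elim (¬u→y u→y)
PhyAdj⇒ForwardAdj _ (_ , inj₂ (inj₂ common)) = inj₂ common

ForwardAdj-self : ∀ {n} {D : Digraph n} {y u} → ForwardAdj D y u → ForwardAdj D y y
ForwardAdj-self {u = u} (inj₁ y→u) = inj₂ (u , y→u , y→u)
ForwardAdj-self (inj₂ (w , y→w , _)) = inj₂ (w , y→w , y→w)

module _ {n} (D : Digraph n) (y : Fin n) where

  private
    E = addOutTwin D y

  addOutTwin-unreachable : ∀ {x} → ¬ Reach E x zero
  addOutTwin-unreachable (step ())
  addOutTwin-unreachable (_ then r) = addOutTwin-unreachable r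

  addOutTwin-reach : ∀ {u v} → Reach E (suc u) (suc v) → Reach D u v
  addOutTwin-reach (step u→v) = step u→v
  addOutTwin-reach (_then_ {v = zero} () _)
  addOutTwin-reach (_then_ {v = suc w} u→w r) = u→w then addOutTwin-reach r

  addOutTwin-acyclic : Acyclic D → Acyclic E
  addOutTwin-acyclic _ zero = addOutTwin-unreachable
  addOutTwin-acyclic acyclic (suc v) = acyclic v ∘ addOutTwin-reach

  indeg-addOutTwin-zero : indeg E zero ≡ 0
  indeg-addOutTwin-zero =
    cong length (filter-none (λ u → arc E u zero ≟ᵇ true) (universal (λ _ ()) (allFin (suc n))))

  indeg-addOutTwin-suc : ∀ v → indeg E (suc v) ≤ suc (indeg D v)
  indeg-addOutTwin-suc v = subst (_≤ suc (indeg D v)) (≡.sym (length-filter-allFin-suc into))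
    (+-monoˡ-≤ (indeg D v) (length-filter into (zero ∷ [])))
    where into = λ u → arc E u (suc v) ≟ᵇ true

  outdeg-addOutTwin-zero : outdeg E zero ≡ outdeg D y
  outdeg-addOutTwin-zero = length-filter-allFin-suc (λ v → arc E zero v ≟ᵇ true)

  outdeg-addOutTwin-suc : ∀ u → outdeg E (suc u) ≡ outdeg D u
  outdeg-addOutTwin-suc u = length-filter-allFin-suc (λ v → arc E (suc u) v ≟ᵇ true)

  addOutTwin-IJDigraph : ∀ {i j} → IJDigraph i j D → IJDigraph (suc i) j E
  addOutTwin-IJDigraph {i} {j} (acyclic , deg) = addOutTwin-acyclic acyclic , deg′
    where
    deg′ : ∀ v → indeg E v ≤ suc i × outdeg E v ≤ j
    deg′ zero = subst (_≤ suc i) (≡.sym indeg-addOutTwin-zero) z≤n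
              , subst (_≤ j) (≡.sym outdeg-addOutTwin-zero) (proj₂ (deg y))
    deg′ (suc v) = ≤-trans (indeg-addOutTwin-suc v) (s≤s (proj₁ (deg v)))
                 , subst (_≤ j) (≡.sym (outdeg-addOutTwin-suc v)) (proj₂ (deg v))

  PhyAdj-addOutTwin : ∀ {u v} → PhyAdj D u v → PhyAdj E (suc u) (suc v)
  PhyAdj-addOutTwin (u≢v , inj₁ u→v) = u≢v ∘ suc-injective , inj₁ u→v
  PhyAdj-addOutTwin (u≢v , inj₂ (inj₁ v→u)) = u≢v ∘ suc-injective , inj₂ (inj₁ v→u)
  PhyAdj-addOutTwin (u≢v , inj₂ (inj₂ (w , u→w , v→w))) =
    u≢v ∘ suc-injective , inj₂ (inj₂ (suc w , u→w , v→w))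

  PhyAdj-addOutTwin-zero : ∀ {u} → ForwardAdj D y u → PhyAdj E zero (suc u)
  PhyAdj-addOutTwin-zero (inj₁ y→u) = (λ ()) , inj₁ y→u
  PhyAdj-addOutTwin-zero (inj₂ (w , y→w , u→w)) = (λ ()) , inj₂ (inj₂ (suc w , y→w , u→w))

addOutTwin-Clique : ∀ {n l} {D : Digraph n} (f : Fin (suc (suc l)) → Fin n) →
  (∀ b c → b ≢ c → PhyAdj D (f b) (f c)) → ∀ {a} → (∀ b → ¬ Arc D (f b) (f a)) →
  Clique (P (addOutTwin D (f a))) (suc (suc (suc l)))
addOutTwin-Clique {n} {l} {D} f adj {a} source = g , adj′
  where
  forward : ∀ b → ForwardAdj D (f a) (f b)
  forward b with b ≟ᶠ a
  ... | yes refl =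
    ForwardAdj-self {D = D}
      (PhyAdj⇒ForwardAdj {D = D} (source other) (adj a other (punchInᵢ≢i a zero ∘ ≡.sym)))
    where other = punchIn a zero
  ... | no b≢a = PhyAdj⇒ForwardAdj {D = D} (source b) (adj a b (b≢a ∘ ≡.sym))

  g : Fin (suc (suc (suc l))) → Fin (suc n)
  g zero = zero
  g (suc b) = suc (f b)

  adj′ : ∀ b c → b ≢ c → PhyAdj (addOutTwin D (f a)) (g b) (g c)
  adj′ zero zero b≢c = ⊥-elim (b≢c refl)
  adj′ zero (suc c) _ = PhyAdj-addOutTwin-zero D (f a) (forward c)
  adj′ (suc b) zero _ = Graph.sym (P (addOutTwin D (f a))) (PhyAdj-addOutTwin-zero D (f a) (forward b))
  adj′ (suc b) (suc c) b≢c = PhyAdj-addOutTwin D (f a) (adj b c (b≢c ∘ cong suc))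

HasPhylogenyClique : ℕ → ℕ → ℕ → Set
HasPhylogenyClique i j l = Σ ℕ λ n → Σ (Digraph n) λ D → IJDigraph i j D × Clique (P D) l

HasPhylogenyClique-suc : ∀ {i j l} → 2 ≤ l →
  HasPhylogenyClique i j l → HasPhylogenyClique (suc i) j (suc l)
HasPhylogenyClique-suc (s≤s (s≤s z≤n)) (n , D , ij@(acyclic , _) , f , adj)
  with a , source ← acyclic⇒source D acyclic f
  = suc n , addOutTwin D (f a) , addOutTwin-IJDigraph D (f a) ij , addOutTwin-Clique f adj source

HasPhylogenyClique-+ : ∀ {i j l} m → 2 ≤ l →
  HasPhylogenyClique i j l → HasPhylogenyClique (m + i) j (m + l)
HasPhylogenyClique-+ 0 _ K = K
HasPhylogenyClique-+ {l = l} (suc m) 2≤l K =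
  HasPhylogenyClique-suc (≤-trans 2≤l (m≤n+m l m)) (HasPhylogenyClique-+ m 2≤l K)

lemma3p11 : (i j l : ℕ) → 1 ≤ i → 1 ≤ j → 2 ≤ l →
    Σ ℕ (λ n → Σ (Graph n) λ G → IsPhylogenyGraph i j G × ContainsInducedClique G l) →
    (m : ℕ) → 1 ≤ m →
    Σ ℕ (λ n → Σ (Graph n) λ G → IsPhylogenyGraph (i + m) j G × ContainsInducedClique G (l + m))
lemma3p11 i j l _ _ 2≤l (n , G , (D , ij , G≅PD) , f , _ , adj) m _
  with n′ , D′ , ij′ , K′ ← subst₂ (λ i′ l′ → HasPhylogenyClique i′ j l′) (+-comm m i) (+-comm m l)
                              (HasPhylogenyClique-+ m 2≤l (n , D , ij , Clique-≅ G≅PD (f , adj)))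
  = n′ , P D′ , P-isPhylogenyGraph ij′ , Clique⇒ContainsInducedClique {G = P D′} K′
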